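{- Let $k\geq 1$ be an integer. For a $k$-strict partition $\pi$, let $\pi^2$ be the partition obtained as follows: for every part value $p$ occurring in $\pi$ with multiplicity $m_p$, $\pi^2$ contains $p$ with multiplicity $2\lfloor m_p/2\rfloor$; and let $\pi^1$ be the partition containing each part value $p$ of $\pi$ with multiplicity $m_p-2\lfloor m_p/2\rfloor$. Then the map $\psi_k:\pi\mapsto(\pi^1,\pi^2)$ is a bijection from $\mathcal{S}^k$ to $\mathcal{DS}^k\times\mathcal{E}^k$ such that $\ell(\pi)=\ell(\pi^1)+\ell(\pi^2)$ and $$\omega^k_{\pi}\big((a_i),(b_i)\big)=\omega^k_{\pi^1}\big((a_i),(b_i)\big)\,\omega^k_{\pi^2}\big((a_i),(b_i)\big).$$
   Context: A partition $\pi$ is $k$-strict if for every $m\in\mathbb{N}$ and all $1\le r_1\le r_2\le k-1$, the numbers $mk+r_1$ and $mk+r_2$ do not appear together as parts of $\pi$ (in particular, with $r_1=r_2$, parts not divisible by $k$ are not repeated); equivalently at most one part (counted with multiplicity) lies in each block $\{mk+1,\dots,mk+k-1\}$. $\mathcal{S}^k$ is the set of $k$-strict partitions; $\mathcal{D}$ is the set of partitions into distinct parts; $\mathcal{DS}^k=\mathcal{D}\cap\mathcal{S}^k$; $\mathcal{E}^k$ is the set of partitions all of whose parts are $\equiv 0\pmod k$ and each part occurs an even number of times. $\ell(\pi)$ is the number of parts. For commuting variables $a_1,\dots,a_k,b_1,\dots,b_k$, the weight $\omega^k_\pi((a_i),(b_i))$ is defined by labelling the cells of each odd-indexed row of the Ferrers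 diagram of $\pi$ (rows $\pi_1\ge\pi_2\ge\cdots$, top row indexed 1) from left to right cyclically by $a_1,a_2,\dots,a_k,a_1,\dots$, the cells of each even-indexed row cyclically by $b_1,\dots,b_k,b_1,\dots$, and taking the product of all labels. -}

module Defs where

open import Level using (Level)
open import Data.Nat using (ℕ; zero; suc; _+_; _*_; _∸_; _<_; _≟_; NonZero)
open import Data.Nat.DivMod using (_/_; _%_; _mod_)
open import Data.Nat.Divisibility using (_∣_)
open import Data.Fin using (Fin)
open import Data.List using (List; []; _∷_; length; filter; deduplicate; concatMap; replicate)
open import Data.List.Relation.Unary.All using (All)
open import Data.List.Relation.Unary.Linked using (Linked)
open import Data.List.Relation.Unary.AllPairs using (AllPairs)
open import Data.Product using (_×_)
open import Relation.Nullary using (¬_)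
open import Relation.Binary.PropositionalEquality using (_≡_; _≢_)
open import Algebra.Bundles using (CommutativeMonoid)

IsPartition : List ℕ → Set
IsPartition π = Linked (λ x y → y Data.Nat.≤ x) π × All (0 <_) π

mult : ℕ → List ℕ → ℕ
mult p π = length (filter (_≟ p) π)

-- x and y lie in a common block {mk+1, …, mk+k-1} (m ∈ ℕ, m ≥ 0).
SameBlock : (k : ℕ) .{{_ : NonZero k}} → ℕ → ℕ → Set
SameBlock k x y = (x % k ≢ 0) × (y % k ≢ 0) × (x / k ≡ y / k)

-- k-strict: no two parts (at distinct positions, i.e. counted with
-- multiplicity) lie in a common block.
KStrict : (k : ℕ) .{{_ : NonZero k}} → List ℕ → Set
KStrict k π = AllPairs (λ x y → ¬ SameBlock k x y) π

InS : (k : ℕ) .{{_ : NonZero k}} → List ℕ → Set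
InS k π = IsPartition π × KStrict k π

Distinct : List ℕ → Set
Distinct π = AllPairs _≢_ π

InDS : (k : ℕ) .{{_ : NonZero k}} → List ℕ → Set
InDS k π = IsPartition π × Distinct π × KStrict k π

InE : (k : ℕ) → List ℕ → Set
InE k π = IsPartition π × All (k ∣_) π × (∀ p → 2 ∣ mult p π)

values : List ℕ → List ℕ
values = deduplicate _≟_

psi2 : List ℕ → List ℕ
psi2 π = concatMap (λ p → replicate (2 * (mult p π / 2)) p) (values π)

psi1 : List ℕ → List ℕ
psi1 π = concatMap (λ p → replicate (mult p π ∸ 2 * (mult p π / 2)) p) (values π)

module Weight {c ℓ : Level} (M : CommutativeMonoid c ℓ) where
  open CommutativeMonoid M

  rowW : (k : ℕ) .{{_ : NonZero k}} → (Fin k → Carrier) → ℕ → Carrier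
  rowW k lab zero = ε
  rowW k lab (suc n) = rowW k lab n ∙ lab (n mod k)

  ω : (k : ℕ) .{{_ : NonZero k}} → (Fin k → Carrier) → (Fin k → Carrier) → List ℕ → Carrier
  ω k a b [] = ε
  ω k a b (x ∷ π) = rowW k a x ∙ ω k b a π

-- In a weakly decreasing π equal parts are adjacent, so greedily pairing off
-- equal neighbours splits π into a strictly decreasing list of singles and a
-- list of adjacent pairs x, x; comparing multiplicities shows that these are
-- exactly π¹ and π². A k-strict partition can repeat only parts lying in no
-- block, i.e. multiples of k, which puts π² in ℰ^k; conversely, sorting
-- μ ++ ν inverts ψ_k. For the weight, a pair of equal rows contributes
-- rowW a x ∙ rowW b x, which is symmetric in a and b, so deleting the pair
-- leaves the alternating labels of the remaining rows unchanged.

module Submission where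

open import Defs
open import Level using (Level)
open import Algebra.Bundles using (CommutativeMonoid)
import Algebra.Properties.CommutativeSemigroup as CommutativeSemigroupProperties
open import Data.Fin using (Fin)
open import Data.Nat using (ℕ; NonZero; zero; suc; _+_; _*_; _∸_; _≤_; _<_; z≤n; s≤s; z<s; _≟_)
open import Data.List using (List; []; _∷_; _++_; length; filter; replicate; concatMap)
open import Data.List.Properties using (filter-++; filter-accept; filter-reject; filter-all; filter-none; length-++; length-replicate)
open import Data.List.Membership.Propositional using (_∈_; _∉_)
open import Data.List.Membership.Propositional.Properties using (∈-deduplicate⁺; ∈-deduplicate⁻)
open import Data.List.Membership.DecPropositional _≟_ using (_∈?_)
open import Data.List.Relation.Binary.Permutation.Propositional using (_↭_; ↭-refl; ↭-prep; ↭-sym; ↭-trans; ↭⇒↭ₛ)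
open import Data.List.Relation.Binary.Permutation.Propositional.Properties using (↭-length; filter-↭; shift; All-resp-↭)
import Data.List.Relation.Binary.Permutation.Setoid.Properties as SetoidPermutation
open import Data.List.Relation.Binary.Sublist.Propositional using (_⊆_; []; _∷ʳ_; _∷_)
open import Data.List.Relation.Binary.Sublist.Propositional.Properties using (All-resp-⊆)
open import Data.List.Relation.Unary.All as All using (All; []; _∷_)
import Data.List.Relation.Unary.All.Properties as Allₚ
open import Data.List.Relation.Unary.AllPairs as AllPairs using (AllPairs; []; _∷_)
import Data.List.Relation.Unary.AllPairs.Properties as AllPairsₚ
open import Data.List.Relation.Unary.Any using (here; there)
open import Data.List.Relation.Unary.Linked.Properties using (AllPairs⇒Linked; Linked⇒AllPairs)
open import Data.List.Relation.Unary.Unique.DecPropositional.Properties _≟_ using (deduplicate-!)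
open import Data.Nat.DivMod using (_/_; _%_; m*n/n≡m; m<n⇒m/n≡0; +-distrib-/-∣ʳ)
open import Data.Nat.Divisibility using (_∣_; divides; ∣-refl; ∣m∣n⇒∣m+n; m%n≡0⇒n∣m; n∣m⇒m%n≡0)
open import Data.Nat.Properties
open import Data.Product using (_×_; Σ-syntax; _,_; proj₁; proj₂)
open import Function using (_∘_)
open import Relation.Binary.Properties.DecTotalOrder ≤-decTotalOrder using (≥-decTotalOrder)
open import Data.List.Sort ≥-decTotalOrder using (sort; sort-↭; sort-↗)
open import Relation.Nullary using (¬_; Dec; yes; no; contradiction)
open import Relation.Binary.PropositionalEquality
  using (_≡_; _≢_; refl; sym; trans; cong; cong₂; subst; resp₂; module ≡-Reasoning)
  renaming (setoid to ≡-setoid)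

Descending : List ℕ → Set
Descending = AllPairs (λ x y → y ≤ x)

StrictlyDescending : List ℕ → Set
StrictlyDescending = AllPairs (λ x y → y < x)

partition⇒descending : ∀ {π} → IsPartition π → Descending π
partition⇒descending (linked , _) = Linked⇒AllPairs (λ y≤x z≤y → ≤-trans z≤y y≤x) linked

AllPairs-resp-⊆ : ∀ {a r} {A : Set a} {R : A → A → Set r} {xs ys : List A} →
                  xs ⊆ ys → AllPairs R ys → AllPairs R xs
AllPairs-resp-⊆ [] [] = []
AllPairs-resp-⊆ (_ ∷ʳ xs⊆ys) (_ ∷ rys) = AllPairs-resp-⊆ xs⊆ys rys
AllPairs-resp-⊆ (refl ∷ xs⊆ys) (ry ∷ rys) = All-resp-⊆ xs⊆ys ry ∷ AllPairs-resp-⊆ xs⊆ys rys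

sublist-of-partition : ∀ {xs π} → xs ⊆ π → IsPartition π → IsPartition xs
sublist-of-partition xs⊆π p@(_ , pos) =
  AllPairs⇒Linked (AllPairs-resp-⊆ xs⊆π (partition⇒descending p)) , All-resp-⊆ xs⊆π pos

mult-here : ∀ q xs → mult q (q ∷ xs) ≡ suc (mult q xs)
mult-here q xs = cong length (filter-accept (_≟ q) refl)

mult-skip : ∀ {x q} xs → x ≢ q → mult q (x ∷ xs) ≡ mult q xs
mult-skip {q = q} xs x≢q = cong length (filter-reject (_≟ q) x≢q)

mult-++ : ∀ q xs ys → mult q (xs ++ ys) ≡ mult q xs + mult q ys
mult-++ q xs ys = trans (cong length (filter-++ (_≟ q) xs ys)) (length-++ (filter (_≟ q) xs))

mult-↭ : ∀ q {xs ys} → xs ↭ ys → mult q xs ≡ mult q ys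
mult-↭ q xs↭ys = ↭-length (filter-↭ (_≟ q) xs↭ys)

mult-∉ : ∀ {q xs} → q ∉ xs → mult q xs ≡ 0
mult-∉ {q} q∉xs = cong length (filter-none (_≟ q) (All.tabulate λ { x∈xs refl → q∉xs x∈xs }))

∈⇒mult>0 : ∀ {q xs} → q ∈ xs → 0 < mult q xs
∈⇒mult>0 {q} (here refl) = subst (0 <_) (sym (mult-here q _)) z<s
∈⇒mult>0 {q} {x ∷ xs} (there q∈xs) with x ≟ q
... | yes refl = subst (0 <_) (sym (mult-here q xs)) z<s
... | no x≢q = subst (0 <_) (sym (mult-skip xs x≢q)) (∈⇒mult>0 q∈xs)

mult>0⇒∈ : ∀ {q xs} → 0 < mult q xs → q ∈ xs
mult>0⇒∈ {q} {xs} pos with q ∈? xs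
... | yes q∈xs = q∈xs
... | no q∉xs = contradiction (sym (mult-∉ q∉xs)) (<⇒≢ pos)

∈-resp-mult : ∀ {xs ys} → (∀ q → mult q xs ≡ mult q ys) → ∀ {z} → z ∈ xs → z ∈ ys
∈-resp-mult same {z} z∈xs = mult>0⇒∈ (subst (0 <_) (same z) (∈⇒mult>0 z∈xs))

mult-distinct-∈ : ∀ {q xs} → Distinct xs → q ∈ xs → mult q xs ≡ 1
mult-distinct-∈ {q} (q∉xs ∷ _) (here refl) =
  trans (mult-here q _) (cong suc (mult-∉ λ q∈xs → All.lookup q∉xs q∈xs refl))
mult-distinct-∈ {xs = _ ∷ xs} (x∉xs ∷ distinct) (there q∈xs) =
  trans (mult-skip xs (All.lookup x∉xs q∈xs)) (mult-distinct-∈ distinct q∈xs)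

mult-distinct≤1 : ∀ q {xs} → Distinct xs → mult q xs ≤ 1
mult-distinct≤1 q {xs} distinct with q ∈? xs
... | yes q∈xs = ≤-reflexive (mult-distinct-∈ distinct q∈xs)
... | no q∉xs = subst (_≤ 1) (sym (mult-∉ q∉xs)) z≤n

mult-∷-cancel : ∀ {q} x {xs ys} → mult q (x ∷ xs) ≡ mult q (x ∷ ys) → mult q xs ≡ mult q ys
mult-∷-cancel {q} x {xs} {ys} eq =
  +-cancelˡ-≡ (mult q (x ∷ [])) _ _ (trans (sym (mult-++ q (x ∷ []) xs)) (trans eq (mult-++ q (x ∷ []) ys)))

descending-mult-ext : ∀ {xs ys} → Descending xs → Descending ys → (∀ q → mult q xs ≡ mult q ys) → xs ≡ ys
descending-mult-ext {[]} {[]} _ _ _ = refl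
descending-mult-ext {[]} {y ∷ ys} _ _ same = contradiction (same y) (<⇒≢ (∈⇒mult>0 {y} {y ∷ ys} (here refl)))
descending-mult-ext {x ∷ xs} {[]} _ _ same = contradiction (sym (same x)) (<⇒≢ (∈⇒mult>0 {x} {x ∷ xs} (here refl)))
descending-mult-ext {x ∷ xs} {y ∷ ys} (x≥xs ∷ dxs) (y≥ys ∷ dys) same
  with ≤-antisym (All.lookup (≤-refl ∷ y≥ys) (∈-resp-mult same (here refl)))
                 (All.lookup (≤-refl ∷ x≥xs) (∈-resp-mult (sym ∘ same) (here refl)))
... | refl = cong (x ∷_) (descending-mult-ext dxs dys (λ q → mult-∷-cancel x (same q)))

mult-replicate-self : ∀ n q → mult q (replicate n q) ≡ n
mult-replicate-self n q = trans (cong length (filter-all (_≟ q) (Allₚ.replicate⁺ n refl))) (length-replicate n)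

mult-replicate-other : ∀ n {p q} → p ≢ q → mult q (replicate n p) ≡ 0
mult-replicate-other n {q = q} p≢q = cong length (filter-none (_≟ q) (Allₚ.replicate⁺ n p≢q))

mult-concatMap-replicate : ∀ (h : ℕ → ℕ) q vs →
  mult q (concatMap (λ p → replicate (h p) p) vs) ≡ mult q vs * h q
mult-concatMap-replicate h q [] = refl
mult-concatMap-replicate h q (v ∷ vs) with v ≟ q
... | yes refl = begin
  mult q (replicate (h q) q ++ concatMap (λ p → replicate (h p) p) vs)
    ≡⟨ mult-++ q (replicate (h q) q) _ ⟩
  mult q (replicate (h q) q) + mult q (concatMap (λ p → replicate (h p) p) vs)
    ≡⟨ cong₂ _+_ (mult-replicate-self (h q) q) (mult-concatMap-replicate h q vs) ⟩
  suc (mult q vs) * h q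
    ≡⟨ cong (_* h q) (mult-here q vs) ⟨
  mult q (q ∷ vs) * h q ∎
  where open ≡-Reasoning
... | no v≢q = begin
  mult q (replicate (h v) v ++ concatMap (λ p → replicate (h p) p) vs)
    ≡⟨ mult-++ q (replicate (h v) v) _ ⟩
  mult q (replicate (h v) v) + mult q (concatMap (λ p → replicate (h p) p) vs)
    ≡⟨ cong₂ _+_ (mult-replicate-other (h v) v≢q) (mult-concatMap-replicate h q vs) ⟩
  mult q vs * h q
    ≡⟨ cong (_* h q) (mult-skip vs v≢q) ⟨
  mult q (v ∷ vs) * h q ∎
  where open ≡-Reasoning

-- psi1 = ψ oddPart and psi2 = ψ evenPart hold definitionally.
ψ : (ℕ → ℕ) → List ℕ → List ℕ
ψ g π = concatMap (λ p → replicate (g (mult p π)) p) (values π)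

oddPart evenPart : ℕ → ℕ
oddPart m = m ∸ 2 * (m / 2)
evenPart m = 2 * (m / 2)

mult-ψ : ∀ g → g 0 ≡ 0 → ∀ q π → mult q (ψ g π) ≡ g (mult q π)
mult-ψ g g0≡0 q π with q ∈? π
... | yes q∈π = begin
  mult q (ψ g π)                   ≡⟨ mult-concatMap-replicate _ q (values π) ⟩
  mult q (values π) * g (mult q π) ≡⟨ cong (_* g (mult q π)) (mult-distinct-∈ (deduplicate-! π) q∈values) ⟩
  1 * g (mult q π)                 ≡⟨ *-identityˡ _ ⟩
  g (mult q π)                     ∎
  where
  open ≡-Reasoning
  q∈values : q ∈ values π
  q∈values = ∈-deduplicate⁺ _≟_ q∈π
... | no q∉π = begin
  mult q (ψ g π)                   ≡⟨ mult-concatMap-replicate _ q (values π) ⟩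
  mult q (values π) * g (mult q π) ≡⟨ cong (_* g (mult q π)) (mult-∉ (q∉π ∘ ∈-deduplicate⁻ _≟_ π)) ⟩
  0                                ≡⟨ g0≡0 ⟨
  g 0                              ≡⟨ cong g (mult-∉ q∉π) ⟨
  g (mult q π)                     ∎
  where open ≡-Reasoning

values-descending : ∀ {π} → Descending π → Descending (values π)
values-descending [] = []
values-descending {x ∷ _} (x≥xs ∷ dxs) =
  Allₚ.filter⁺ _ (Allₚ.deduplicate⁺ _≟_ x≥xs) ∷ AllPairsₚ.filter⁺ _ (values-descending dxs)

replicate-descending : ∀ n v → Descending (replicate n v)
replicate-descending zero v = []
replicate-descending (suc n) v = Allₚ.replicate⁺ n ≤-refl ∷ replicate-descending n v

concatMap-replicate-descending : ∀ (h : ℕ → ℕ) {vs} → Descending vs →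
  Descending (concatMap (λ p → replicate (h p) p) vs)
concatMap-replicate-descending h [] = []
concatMap-replicate-descending h {v ∷ _} (v≥vs ∷ dvs) =
  AllPairsₚ.++⁺ (replicate-descending (h v) v) (concatMap-replicate-descending h dvs)
    (Allₚ.replicate⁺ (h v) (Allₚ.concat⁺ (Allₚ.map⁺ (All.map (Allₚ.replicate⁺ _) v≥vs))))

ψ-descending : ∀ g {π} → Descending π → Descending (ψ g π)
ψ-descending g dπ = concatMap-replicate-descending _ (values-descending dπ)

parity-split : ∀ {a b} → a ≤ 1 → 2 ∣ b → oddPart (a + b) ≡ a × evenPart (a + b) ≡ b
parity-split {a} a≤1 (divides c refl) = odd , even
  where
  half : (a + c * 2) / 2 ≡ c
  half = begin
    (a + c * 2) / 2     ≡⟨ +-distrib-/-∣ʳ a (divides c refl) ⟩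
    a / 2 + c * 2 / 2   ≡⟨ cong₂ _+_ (m<n⇒m/n≡0 (s≤s a≤1)) (m*n/n≡m c 2) ⟩
    c                   ∎
    where open ≡-Reasoning
  even : evenPart (a + c * 2) ≡ c * 2
  even = trans (cong (2 *_) half) (*-comm 2 c)
  odd : oddPart (a + c * 2) ≡ a
  odd = trans (cong (a + c * 2 ∸_) even) (m+n∸n≡m a (c * 2))

psi-characterisation : ∀ {π u v} → Descending π → Descending u → Descending v → Distinct u →
  (∀ q → 2 ∣ mult q v) → (∀ q → mult q π ≡ mult q u + mult q v) → psi1 π ≡ u × psi2 π ≡ v
psi-characterisation {π} {u} {v} dπ du dv u-distinct v-even π≡u+v =
  descending-mult-ext (ψ-descending oddPart dπ) du (proj₁ ∘ parts) ,
  descending-mult-ext (ψ-descending evenPart dπ) dv (proj₂ ∘ parts)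
  where
  parts : ∀ q → mult q (psi1 π) ≡ mult q u × mult q (psi2 π) ≡ mult q v
  parts q with parity-split (mult-distinct≤1 q u-distinct) (v-even q)
  ... | odd , even = trans (mult-ψ oddPart refl q π) (trans (cong oddPart (π≡u+v q)) odd)
                   , trans (mult-ψ evenPart refl q π) (trans (cong evenPart (π≡u+v q)) even)

data Pairing : List ℕ → List ℕ → List ℕ → Set where
  []     : Pairing [] [] []
  single : ∀ {x π s d} → Pairing π s d → Pairing (x ∷ π) (x ∷ s) d
  double : ∀ {x π s d} → Pairing π s d → Pairing (x ∷ x ∷ π) s (x ∷ x ∷ d)

pairing-singles-⊆ : ∀ {π s d} → Pairing π s d → s ⊆ π
pairing-singles-⊆ [] = []
pairing-singles-⊆ (single p) = refl ∷ pairing-singles-⊆ p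
pairing-singles-⊆ (double {x} p) = x ∷ʳ (x ∷ʳ pairing-singles-⊆ p)

pairing-doubles-⊆ : ∀ {π s d} → Pairing π s d → d ⊆ π
pairing-doubles-⊆ [] = []
pairing-doubles-⊆ (single {x} p) = x ∷ʳ pairing-doubles-⊆ p
pairing-doubles-⊆ (double p) = refl ∷ (refl ∷ pairing-doubles-⊆ p)

pairing-↭ : ∀ {π s d} → Pairing π s d → π ↭ s ++ d
pairing-↭ [] = ↭-refl
pairing-↭ (single {x} p) = ↭-prep x (pairing-↭ p)
pairing-↭ (double {x} {s = s} {d} p) =
  ↭-trans (↭-prep x (↭-prep x (pairing-↭ p)))
          (↭-trans (↭-prep x (↭-sym (shift x s d))) (↭-sym (shift x s (x ∷ d))))

pairing-doubles-even : ∀ {π s d} → Pairing π s d → ∀ q → 2 ∣ mult q d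
pairing-doubles-even [] q = divides 0 refl
pairing-doubles-even (single p) q = pairing-doubles-even p q
pairing-doubles-even (double {x} {d = d} p) q with x ≟ q
... | yes refl = subst (2 ∣_) (sym (trans (mult-here q (q ∷ d)) (cong suc (mult-here q d))))
                       (∣m∣n⇒∣m+n ∣-refl (pairing-doubles-even p q))
... | no x≢q = subst (2 ∣_) (sym (trans (mult-skip (x ∷ d) x≢q) (mult-skip d x≢q)))
                     (pairing-doubles-even p q)

pairing-doubles-diagonal : ∀ {R : ℕ → ℕ → Set} {π s d} → Pairing π s d → AllPairs R π → All (λ x → R x x) d
pairing-doubles-diagonal [] _ = []
pairing-doubles-diagonal (single p) (_ ∷ rπ) = pairing-doubles-diagonal p rπ
pairing-doubles-diagonal (double p) ((rxx ∷ _) ∷ _ ∷ rπ) = rxx ∷ rxx ∷ pairing-doubles-diagonal p rπ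

StrictPairing : List ℕ → Set
StrictPairing π = Σ[ s ∈ List ℕ ] Σ[ d ∈ List ℕ ] (Pairing π s d × StrictlyDescending s)

greedy-pairing : ∀ {π} → Descending π → StrictPairing π
greedy-pairing [] = [] , [] , [] , []
greedy-pairing (_ ∷ []) = _ , [] , single [] , [] ∷ []
greedy-pairing {x ∷ y ∷ r} ((y≤x ∷ _) ∷ dyr@(r≤y ∷ dr)) = extend (x ≟ y) (greedy-pairing dr) (greedy-pairing dyr)
  where
  extend : Dec (x ≡ y) → StrictPairing r → StrictPairing (y ∷ r) → StrictPairing (x ∷ y ∷ r)
  extend (yes refl) (s , d , p , ds) _ = s , _ , double p , ds
  extend (no x≢y) _ (s , d , p , ds) = _ , d , single p , All-resp-⊆ (pairing-singles-⊆ p) below-x ∷ ds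
    where
    y<x : y < x
    y<x = ≤∧≢⇒< y≤x (x≢y ∘ sym)
    below-x : All (_< x) (y ∷ r)
    below-x = y<x ∷ All.map (λ z≤y → ≤-<-trans z≤y y<x) r≤y

mult-pairing : ∀ {π s d} → Pairing π s d → ∀ q → mult q π ≡ mult q s + mult q d
mult-pairing {s = s} {d} p q = trans (mult-↭ q (pairing-↭ p)) (mult-++ q s d)

psi-pairing : ∀ {π} → Descending π → Pairing π (psi1 π) (psi2 π) × StrictlyDescending (psi1 π)
psi-pairing dπ with greedy-pairing dπ
... | s , d , p , ds
    with psi-characterisation dπ
           (AllPairs-resp-⊆ (pairing-singles-⊆ p) dπ) (AllPairs-resp-⊆ (pairing-doubles-⊆ p) dπ)
           (AllPairs.map >⇒≢ ds) (pairing-doubles-even p) (mult-pairing p)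
... | refl , refl = p , ds

¬SameBlock-sym : ∀ k .{{_ : NonZero k}} {x y} → ¬ SameBlock k x y → ¬ SameBlock k y x
¬SameBlock-sym k h (x%k≢0 , y%k≢0 , same) = h (y%k≢0 , x%k≢0 , sym same)

¬SameBlock-self⇒∣ : ∀ k .{{_ : NonZero k}} {x} → ¬ SameBlock k x x → k ∣ x
¬SameBlock-self⇒∣ k {x} h with x % k ≟ 0
... | yes x%k≡0 = m%n≡0⇒n∣m x k x%k≡0
... | no x%k≢0 = contradiction (x%k≢0 , x%k≢0 , refl) h

∣⇒¬SameBlock : ∀ k .{{_ : NonZero k}} {x y} → k ∣ y → ¬ SameBlock k x y
∣⇒¬SameBlock k {y = y} k∣y (_ , y%k≢0 , _) = y%k≢0 (n∣m⇒m%n≡0 y k k∣y)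

multiples-kStrict : ∀ k .{{_ : NonZero k}} {ν} → All (k ∣_) ν → KStrict k ν
multiples-kStrict k [] = []
multiples-kStrict k (_ ∷ k∣ν) = All.map (∣⇒¬SameBlock k) k∣ν ∷ multiples-kStrict k k∣ν

kStrict-++-multiples : ∀ k .{{_ : NonZero k}} {μ ν} → KStrict k μ → All (k ∣_) ν → KStrict k (μ ++ ν)
kStrict-++-multiples k μStrict k∣ν =
  AllPairsₚ.++⁺ μStrict (multiples-kStrict k k∣ν) (All.tabulate λ _ → All.map (∣⇒¬SameBlock k) k∣ν)

kStrict-resp-↭ : ∀ k .{{_ : NonZero k}} {xs ys} → xs ↭ ys → KStrict k xs → KStrict k ys
kStrict-resp-↭ k xs↭ys =
  SetoidPermutation.AllPairs-resp-↭ (≡-setoid ℕ) (¬SameBlock-sym k) (resp₂ _) (↭⇒↭ₛ xs↭ys)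

psi-into : ∀ k .{{_ : NonZero k}} {π} → InS k π → InDS k (psi1 π) × InE k (psi2 π)
psi-into k (isPart , kStrict) with psi-pairing (partition⇒descending isPart)
... | p , ds =
  (sublist-of-partition (pairing-singles-⊆ p) isPart ,
   AllPairs.map >⇒≢ ds , AllPairs-resp-⊆ (pairing-singles-⊆ p) kStrict) ,
  (sublist-of-partition (pairing-doubles-⊆ p) isPart ,
   All.map (¬SameBlock-self⇒∣ k) (pairing-doubles-diagonal p kStrict) , pairing-doubles-even p)

psi-injective : ∀ {π π′} → IsPartition π → IsPartition π′ → psi1 π ≡ psi1 π′ → psi2 π ≡ psi2 π′ → π ≡ π′
psi-injective {π} {π′} isPart isPart′ same1 same2 = descending-mult-ext dπ dπ′ λ q → begin
    mult q π                            ≡⟨ mult-pairing (proj₁ (psi-pairing dπ)) q ⟩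
    mult q (psi1 π) + mult q (psi2 π)   ≡⟨ cong₂ _+_ (cong (mult q) same1) (cong (mult q) same2) ⟩
    mult q (psi1 π′) + mult q (psi2 π′) ≡⟨ mult-pairing (proj₁ (psi-pairing dπ′)) q ⟨
    mult q π′                           ∎
  where
  open ≡-Reasoning
  dπ : Descending π
  dπ = partition⇒descending isPart
  dπ′ : Descending π′
  dπ′ = partition⇒descending isPart′

psi-surjective : ∀ k .{{_ : NonZero k}} {μ ν} → InDS k μ → InE k ν →
  Σ[ π ∈ List ℕ ] (InS k π × psi1 π ≡ μ × psi2 π ≡ ν)
psi-surjective k {μ} {ν} (μPart , μDistinct , μStrict) (νPart , k∣ν , νEven) =
  sort (μ ++ ν) , (isPart , kStrict) ,
  psi-characterisation (partition⇒descending isPart) (partition⇒descending μPart) (partition⇒descending νPart)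
    μDistinct νEven (λ q → trans (mult-↭ q sorted↭) (mult-++ q μ ν))
  where
  sorted↭ : sort (μ ++ ν) ↭ μ ++ ν
  sorted↭ = sort-↭ (μ ++ ν)
  isPart : IsPartition (sort (μ ++ ν))
  isPart = sort-↗ (μ ++ ν) , All-resp-↭ (↭-sym sorted↭) (Allₚ.++⁺ (proj₂ μPart) (proj₂ νPart))
  kStrict : KStrict k (sort (μ ++ ν))
  kStrict = kStrict-resp-↭ k (↭-sym sorted↭) (kStrict-++-multiples k μStrict k∣ν)

psi-length : ∀ {π} → IsPartition π → length π ≡ length (psi1 π) + length (psi2 π)
psi-length {π} isPart =
  trans (↭-length (pairing-↭ (proj₁ (psi-pairing (partition⇒descending isPart))))) (length-++ (psi1 π))

module _ {c ℓ} (M : CommutativeMonoid c ℓ) (k : ℕ) .{{_ : NonZero k}} where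
  open CommutativeMonoid M using (_≈_; _∙_; ε; assoc; identityʳ; ∙-congˡ; setoid; commutativeSemigroup)
    renaming (sym to ≈-sym; refl to ≈-refl)
  open CommutativeSemigroupProperties commutativeSemigroup using (x∙yz≈y∙xz)
  open Weight M using (rowW; ω)
  open import Relation.Binary.Reasoning.Setoid setoid

  ω-doubles-swap : ∀ {π s d} → Pairing π s d → ∀ a b → ω k a b d ≈ ω k b a d
  ω-doubles-swap [] a b = ≈-refl
  ω-doubles-swap (single p) a b = ω-doubles-swap p a b
  ω-doubles-swap (double {x} {d = d} p) a b = begin
    rowW k a x ∙ (rowW k b x ∙ ω k a b d) ≈⟨ ∙-congˡ (∙-congˡ (ω-doubles-swap p a b)) ⟩
    rowW k a x ∙ (rowW k b x ∙ ω k b a d) ≈⟨ x∙yz≈y∙xz _ _ _ ⟩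
    rowW k b x ∙ (rowW k a x ∙ ω k b a d) ∎

  ω-pairing : ∀ {π s d} → Pairing π s d → ∀ a b → ω k a b π ≈ ω k a b s ∙ ω k a b d
  ω-pairing [] a b = ≈-sym (identityʳ ε)
  ω-pairing (single {x} {π} {s} {d} p) a b = begin
    rowW k a x ∙ ω k b a π                ≈⟨ ∙-congˡ (ω-pairing p b a) ⟩
    rowW k a x ∙ (ω k b a s ∙ ω k b a d)  ≈⟨ ∙-congˡ (∙-congˡ (ω-doubles-swap p b a)) ⟩
    rowW k a x ∙ (ω k b a s ∙ ω k a b d)  ≈⟨ assoc _ _ _ ⟨
    (rowW k a x ∙ ω k b a s) ∙ ω k a b d  ∎
  ω-pairing (double {x} {π} {s} {d} p) a b = begin
    rowW k a x ∙ (rowW k b x ∙ ω k a b π)                ≈⟨ ∙-congˡ (∙-congˡ (ω-pairing p a b)) ⟩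
    rowW k a x ∙ (rowW k b x ∙ (ω k a b s ∙ ω k a b d))  ≈⟨ ∙-congˡ (x∙yz≈y∙xz _ _ _) ⟩
    rowW k a x ∙ (ω k a b s ∙ (rowW k b x ∙ ω k a b d))  ≈⟨ x∙yz≈y∙xz _ _ _ ⟩
    ω k a b s ∙ (rowW k a x ∙ (rowW k b x ∙ ω k a b d))  ∎

  ω-psi : ∀ a b {π} → IsPartition π → ω k a b π ≈ ω k a b (psi1 π) ∙ ω k a b (psi2 π)
  ω-psi a b isPart = ω-pairing (proj₁ (psi-pairing (partition⇒descending isPart))) a b

theorem2p3 : {c ℓ : Level} (k : ℕ) .{{_ : NonZero k}} →
    ((π : List ℕ) → InS k π → InDS k (psi1 π) × InE k (psi2 π))
    × ((π π′ : List ℕ) → InS k π → InS k π′ → psi1 π ≡ psi1 π′ → psi2 π ≡ psi2 π′ → π ≡ π′)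
    × ((μ ν : List ℕ) → InDS k μ → InE k ν → Σ[ π ∈ List ℕ ] (InS k π × psi1 π ≡ μ × psi2 π ≡ ν))
    × ((π : List ℕ) → InS k π → length π ≡ length (psi1 π) + length (psi2 π))
    × ((M : CommutativeMonoid c ℓ) (a b : Fin k → CommutativeMonoid.Carrier M) (π : List ℕ) → InS k π →
        CommutativeMonoid._≈_ M (Weight.ω M k a b π) (CommutativeMonoid._∙_ M (Weight.ω M k a b (psi1 π)) (Weight.ω M k a b (psi2 π))))
theorem2p3 k =
  (λ _ → psi-into k) ,
  (λ _ _ (isPart , _) (isPart′ , _) → psi-injective isPart isPart′) ,
  (λ _ _ → psi-surjective k) ,
  (λ _ (isPart , _) → psi-length isPart) ,
  (λ M a b _ (isPart , _) → ω-psi M k a b isPart)
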